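{- Let $d\ge 2$. Then: (a) every domain $D\subset T_d$ with $|D|\le d$ is optimal; (b) every full domain is optimal; (c) if $D$ is a domain with $|D|\ge 2$ and $|R(D)|=1$, then $D$ is optimal; (d) if $D$ is an optimal domain with $|D|\ge 2$, then $|R(D)|\le d-2$.
   Context: $T_d$ is the $d$-regular tree. A domain is a finite nonempty connected set of vertices of $T_d$. For $x\in D$, $\deg_D(x)$ is the number of neighbors of $x$ in $D$; $\partial D=\{x\in D\mid \deg_D(x)<d\}$. $I_d(k)=\min\{|\partial D|\mid D \text{ a domain},\ |D|=k\}$, and $D$ is optimal if $|\partial D|=I_d(|D|)$. For $|D|\ge 2$: the leaf boundary is $L(D)=\{x\in\partial D\mid\deg_D(x)=1\}$, the residual boundary is $R(D)=\{x\in\partial D\mid 2\le\deg_D(x)\le d-1\}$; $D$ is full if $|D|\ge 2$ and $\partial D=L(D)$ (equivalently $R(D)=\emptyset$). -}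

module Defs where

open import Data.Nat using (ℕ; zero; suc; _≤_; _<_; _∸_)
open import Data.Nat.Properties using (_<?_; _≤?_)
import Data.Nat.Properties as ℕP
open import Data.Fin using (Fin)
import Data.Fin as F
open import Data.List using (List; []; _∷_; length; filter; allFin)
import Data.List.Properties as LP
open import Data.List.Relation.Unary.All using (All)
open import Data.List.Relation.Unary.Unique.Propositional using (Unique)
open import Data.Bool using (Bool; true; false; if_then_else_)
open import Data.Product using (_×_; Σ; ∃)
open import Relation.Nullary using (¬_; Dec; yes; no)
open import Relation.Nullary.Decidable using (_×-dec_)
open import Relation.Nullary.Decidable using (⌊_⌋)
open import Relation.Binary.PropositionalEquality using (_≡_; _≢_)
open import Relation.Unary using (Decidable)
open import Relation.Binary using (DecidableEquality)

-- Model of the d-regular tree T_d: the Cayley graph of the free product of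
-- d copies of Z/2.  A vertex is a reduced word over the alphabet Fin d
-- (no two consecutive equal letters), stored with the LAST letter at the head.
Word : ℕ → Set
Word d = List (Fin d)

data Reduced {d : ℕ} : Word d → Set where
  red-[] : Reduced []
  red-1  : ∀ a → Reduced (a ∷ [])
  red-∷  : ∀ {a b w} → a ≢ b → Reduced (b ∷ w) → Reduced (a ∷ b ∷ w)

-- right multiplication by the generator a: the d neighbours of x are step a x, a : Fin d
step : ∀ {d} → Fin d → Word d → Word d
step a []      = a ∷ []
step a (b ∷ w) = if ⌊ a F.≟ b ⌋ then w else a ∷ b ∷ w

Adj : ∀ {d} → Word d → Word d → Set
Adj {d} x y = ∃ λ (a : Fin d) → y ≡ step a x

_≟w_ : ∀ {d} → DecidableEquality (Word d)
_≟w_ = LP.≡-dec F._≟_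

open import Data.List.Membership.Propositional using (_∈_)
module _ {d : ℕ} where
  open import Data.List.Membership.DecPropositional (_≟w_ {d}) using () renaming (_∈?_ to _∈?w_) public

data Walk {d : ℕ} (D : List (Word d)) : Word d → Word d → Set where
  here  : ∀ {x} → x ∈ D → Walk D x x
  there : ∀ {x y z} → x ∈ D → Adj x y → Walk D y z → Walk D x z

record IsDomain (d : ℕ) (D : List (Word d)) : Set where
  field
    vertices  : All Reduced D
    distinct  : Unique D
    nonempty  : ¬ (D ≡ [])
    connected : ∀ {x y} → x ∈ D → y ∈ D → Walk D x y

deg : ∀ {d} → List (Word d) → Word d → ℕ
deg {d} D x = length (filter (λ a → step a x ∈?w D) (allFin d))

boundary : ∀ {d} → List (Word d) → List (Word d)
boundary {d} D = filter (λ x → deg D x <? d) D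

leafBoundary : ∀ {d} → List (Word d) → List (Word d)
leafBoundary {d} D = filter (λ x → deg D x ℕP.≟ 1) (boundary D)

residualBoundary : ∀ {d} → List (Word d) → List (Word d)
residualBoundary {d} D =
  filter (λ x → (2 ≤? deg D x) ×-dec (deg D x ≤? d ∸ 1)) (boundary D)

Optimal : (d : ℕ) → List (Word d) → Set
Optimal d D = ∀ (D' : List (Word d)) → IsDomain d D' → length D' ≡ length D →
              length (boundary D) ≤ length (boundary D')

Full : (d : ℕ) → List (Word d) → Set
Full d D = 2 ≤ length D × (∀ {x} → x ∈ boundary D → x ∈ leafBoundary D)

{-# OPTIONS --safe #-}
module Submission where

-- Write k = |D|, b = |∂D|, m = |D ∖ ∂D| (the interior vertices, of degree d) and r = |R(D)|.
-- A domain is a subtree, so its degrees sum to 2(k − 1).  Splitting this sum into the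
-- contributions dm of the interior and of ∂D, where a boundary vertex has degree 1 (a leaf)
-- or between 2 and d − 1 (a residual vertex), gives for |D| ≥ 2
--   (d − 1)m + 2 + r  ≤  k  ≤  (d − 1)m + 2 + (d − 2)r.
-- As b = k − m, a domain is optimal as soon as m reaches the largest value ⌊(k − 2)/(d − 1)⌋
-- that the first inequality allows, i.e. as soon as k ≤ (d − 1)m + d.  This holds when k ≤ d,
-- and by the second inequality when r ≤ 1: parts (a)–(c).  Conversely, caterpillars (a path
-- all of whose vertices but the last have their d neighbours in the domain) reach that value
-- in every size, so every optimal domain satisfies k ≤ (d − 1)m + d, and then the first
-- inequality gives r ≤ d − 2: part (d).

open import Defs
open import Data.Nat using (ℕ; zero; suc; _+_; _*_; _≤_; _<_; _∸_; z≤n; s≤s)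
open import Data.Nat.Properties
open import Data.Nat.Tactic.RingSolver using (solve-∀)
open import Data.Fin using (Fin; punchIn; punchOut)
import Data.Fin as F
import Data.Fin.Properties as FP
open import Data.List using (List; []; _∷_; length; filter; allFin; map; take; _++_)
import Data.List.Properties as LP
open import Data.List.Relation.Unary.Any using (here; there)
import Data.List.Relation.Unary.All as All
open import Data.List.Relation.Unary.All using (All; []; _∷_)
open import Data.List.Relation.Unary.AllPairs using ([]; _∷_)
open import Data.List.Relation.Unary.Unique.Propositional using (Unique)
import Data.List.Relation.Unary.Unique.Propositional.Properties as Unique
open import Data.List.Membership.Propositional using (_∈_; _∉_)
open import Data.List.Membership.Propositional.Properties
import Data.List.Membership.Setoid.Properties as Membershipₛ
import Data.List.Relation.Binary.Sublist.Propositional as Sublist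
import Data.List.Relation.Binary.Sublist.Propositional.Properties as Sublist
open import Data.Product using (∃; _×_; _,_; proj₁; proj₂)
open import Data.Sum using (_⊎_; inj₁; inj₂; [_,_]′)
import Data.Sum as Sum
open import Function using (id; _∘_; case_of_)
open import Function.Definitions using (Injective)
open import Data.Empty using (⊥; ⊥-elim)
open import Relation.Nullary using (¬_; Dec; yes; no)
open import Relation.Nullary.Decidable using (_×-dec_)
open import Relation.Unary using (Pred; Decidable)
open import Relation.Unary.Properties using (∁?)
open import Relation.Binary using (DecidableEquality)
open import Relation.Binary.PropositionalEquality

-- Sums over lists

∑ : ∀ {a} {A : Set a} → List A → (A → ℕ) → ℕ
∑ []       f = 0
∑ (x ∷ xs) f = f x + ∑ xs f

syntax ∑ xs (λ x → f) = ∑[ x ∈ xs ] f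

𝟙 : ∀ {p} {P : Set p} → Dec P → ℕ
𝟙 (yes _) = 1
𝟙 (no _)  = 0

module _ {p} {P : Set p} where

  𝟙-yes : (P? : Dec P) → P → 𝟙 P? ≡ 1
  𝟙-yes (yes _) _  = refl
  𝟙-yes (no ¬p) p = ⊥-elim (¬p p)

  𝟙-no : (P? : Dec P) → ¬ P → 𝟙 P? ≡ 0
  𝟙-no (yes p) ¬p = ⊥-elim (¬p p)
  𝟙-no (no _)  _  = refl

module _ {a} {A : Set a} where

  ∑-cong : ∀ {f g : A → ℕ} xs → (∀ {x} → x ∈ xs → f x ≡ g x) → ∑ xs f ≡ ∑ xs g
  ∑-cong []       _   = refl
  ∑-cong (x ∷ xs) f≡g = cong₂ _+_ (f≡g (here refl)) (∑-cong xs (λ x∈xs → f≡g (there x∈xs)))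

  ∑-mono-≤ : ∀ {f g : A → ℕ} xs → (∀ {x} → x ∈ xs → f x ≤ g x) → ∑ xs f ≤ ∑ xs g
  ∑-mono-≤ []       _   = z≤n
  ∑-mono-≤ (x ∷ xs) f≤g =
    +-mono-≤ (f≤g (here refl)) (∑-mono-≤ xs (λ x∈xs → f≤g (there x∈xs)))

  ∑-const : ∀ {f : A → ℕ} {c} xs → (∀ {x} → x ∈ xs → f x ≡ c) → ∑ xs f ≡ length xs * c
  ∑-const []       _    = refl
  ∑-const (x ∷ xs) f≡c = cong₂ _+_ (f≡c (here refl)) (∑-const xs (λ x∈xs → f≡c (there x∈xs)))

  length≡∑1 : ∀ (xs : List A) → length xs ≡ ∑[ x ∈ xs ] 1
  length≡∑1 []       = refl
  length≡∑1 (x ∷ xs) = cong suc (length≡∑1 xs)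

  ∑-zero : ∀ {f : A → ℕ} xs → (∀ {x} → x ∈ xs → f x ≡ 0) → ∑ xs f ≡ 0
  ∑-zero xs f≡0 = trans (∑-const xs f≡0) (*-zeroʳ (length xs))

  ∑-distrib-+ : ∀ (f g : A → ℕ) xs → ∑[ x ∈ xs ] (f x + g x) ≡ ∑ xs f + ∑ xs g
  ∑-distrib-+ f g []       = refl
  ∑-distrib-+ f g (x ∷ xs) =
    trans (cong (f x + g x +_) (∑-distrib-+ f g xs)) (+-+-swap (f x) (g x) _ _)
    where
    +-+-swap : ∀ a b c d → (a + b) + (c + d) ≡ (a + c) + (b + d)
    +-+-swap = solve-∀

  ∑-distribˡ-* : ∀ c (f : A → ℕ) xs → ∑[ x ∈ xs ] (c * f x) ≡ c * ∑ xs f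
  ∑-distribˡ-* c f []       = sym (*-zeroʳ c)
  ∑-distribˡ-* c f (x ∷ xs) =
    trans (cong (c * f x +_) (∑-distribˡ-* c f xs)) (sym (*-distribˡ-+ c (f x) _))

  length-filter≡∑𝟙 : ∀ {p} {P : Pred A p} (P? : Decidable P) xs →
                     length (filter P? xs) ≡ ∑[ x ∈ xs ] 𝟙 (P? x)
  length-filter≡∑𝟙 P? []       = refl
  length-filter≡∑𝟙 P? (x ∷ xs) with P? x
  ... | yes _ = cong suc (length-filter≡∑𝟙 P? xs)
  ... | no  _ = length-filter≡∑𝟙 P? xs

  ∑-filter-split : ∀ {p} {P : Pred A p} (P? : Decidable P) (f : A → ℕ) xs →
                   ∑ xs f ≡ ∑ (filter P? xs) f + ∑ (filter (∁? P?) xs) f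
  ∑-filter-split P? f []       = refl
  ∑-filter-split P? f (x ∷ xs) with P? x
  ... | yes _ = trans (cong (f x +_) (∑-filter-split P? f xs)) (sym (+-assoc (f x) _ _))
  ... | no  _ = trans (cong (f x +_) (∑-filter-split P? f xs))
                      (+-comm-middle (f x) (∑ (filter P? xs) f) (∑ (filter (∁? P?) xs) f))
    where
    +-comm-middle : ∀ a b c → a + (b + c) ≡ b + (a + c)
    +-comm-middle = solve-∀

  length-filter-split : ∀ {p} {P : Pred A p} (P? : Decidable P) xs →
                        length xs ≡ length (filter P? xs) + length (filter (∁? P?) xs)
  length-filter-split P? []       = refl
  length-filter-split P? (x ∷ xs) with P? x
  ... | yes _ = cong suc (length-filter-split P? xs)
  ... | no  _ = trans (cong suc (length-filter-split P? xs)) (sym (+-suc _ _))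

  ∑-single : ∀ (f : A → ℕ) {y} xs → Unique xs → y ∈ xs → (∀ x → x ≢ y → f x ≡ 0) → ∑ xs f ≡ f y
  ∑-single f (x ∷ xs) (x∉xs ∷ _) (here refl) f≡0 =
    trans (cong (f x +_) (∑-zero xs (λ x′∈xs → f≡0 _ (λ x′≡x → All.lookup x∉xs x′∈xs (sym x′≡x)))))
          (+-identityʳ _)
  ∑-single f (x ∷ xs) (x∉xs ∷ u) (there y∈xs) f≡0 =
    trans (cong (_+ ∑ xs f) (f≡0 x (λ x≡y → All.lookup x∉xs y∈xs x≡y)))
          (∑-single f xs u y∈xs f≡0)

∑-swap : ∀ {a b} {A : Set a} {B : Set b} (g : A → B → ℕ) xs ys →
         ∑[ x ∈ xs ] ∑ ys (g x) ≡ ∑[ y ∈ ys ] ∑[ x ∈ xs ] g x y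
∑-swap g []       ys = sym (∑-zero ys (λ _ → refl))
∑-swap g (x ∷ xs) ys = trans (cong (∑ ys (g x) +_) (∑-swap g xs ys)) (sym (∑-distrib-+ (g x) _ ys))

module _ {a} {A : Set a} (_≟_ : DecidableEquality A) where
  open import Data.List.Membership.DecPropositional _≟_ using (_∈?_)

  ∑-𝟙-≟ : ∀ {xs} → Unique xs → ∀ w → ∑[ y ∈ xs ] 𝟙 (y ≟ w) ≡ 𝟙 (w ∈? xs)
  ∑-𝟙-≟ {xs} u w with w ∈? xs
  ... | yes w∈xs = trans (∑-single _ xs u w∈xs (λ y y≢w → 𝟙-no (y ≟ w) y≢w))
                         (𝟙-yes (w ≟ w) refl)
  ... | no  w∉xs = ∑-zero xs (λ y∈xs → 𝟙-no _ (λ y≡w → w∉xs (subst (_∈ xs) y≡w y∈xs)))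

  ∃-≢ : ∀ {xs x} → Unique xs → 2 ≤ length xs → x ∈ xs → ∃ λ y → y ∈ xs × x ≢ y
  ∃-≢ {_ ∷ []}    _                 (s≤s ()) _
  ∃-≢ {p ∷ q ∷ _} {x} ((p≢q ∷ _) ∷ _) _ _ with x ≟ p
  ... | yes refl = q , there (here refl) , p≢q
  ... | no  x≢p  = p , here refl , x≢p

injective⇒≤length : ∀ {a} {A : Set a} {n} {xs : List A} (f : Fin n → A) → Injective _≡_ _≡_ f →
                    (∀ i → f i ∈ xs) → n ≤ length xs
injective⇒≤length f f-injective f∈xs =
  FP.injective⇒≤ λ {i j} index≡ →
    f-injective (Membershipₛ.index-injective (setoid _) (f∈xs i) (f∈xs j) index≡)

all-equal⇒length≡1 : ∀ {a} {A : Set a} {xs : List A} {x} →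
                     Unique xs → x ∈ xs → (∀ {y} → y ∈ xs → y ≡ x) → length xs ≡ 1
all-equal⇒length≡1 {xs = _ ∷ []}    _                 _ _     = refl
all-equal⇒length≡1 {xs = _ ∷ _ ∷ _} ((p≢q ∷ _) ∷ _) _ all≡x =
  ⊥-elim (p≢q (trans (all≡x (here refl)) (sym (all≡x (there (here refl))))))

nonempty⇒∈ : ∀ {a} {A : Set a} {xs : List A} → xs ≢ [] → ∃ λ x → x ∈ xs
nonempty⇒∈ {xs = []}    xs≢[] = ⊥-elim (xs≢[] refl)
nonempty⇒∈ {xs = x ∷ _} _     = x , here refl

-- Steps, parents and the degree sum in T_d

module _ {d : ℕ} where

  step-parent : ∀ (a : Fin d) w → step a (a ∷ w) ≡ w
  step-parent a w with a F.≟ a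
  ... | yes _   = refl
  ... | no  a≢a = ⊥-elim (a≢a refl)

  step-child : ∀ {a : Fin d} {w} → Reduced (a ∷ w) → step a w ≡ a ∷ w
  step-child {w = []}        _             = refl
  step-child {a} {w = b ∷ _} (red-∷ a≢b _) with a F.≟ b
  ... | yes a≡b = ⊥-elim (a≢b a≡b)
  ... | no  _   = refl

  step-cases : ∀ (a : Fin d) x → x ≡ a ∷ step a x ⊎ step a x ≡ a ∷ x
  step-cases a []      = inj₂ refl
  step-cases a (b ∷ w) with a F.≟ b
  ... | yes refl = inj₁ refl
  ... | no  _    = inj₂ refl

  step-neighbour : ∀ (a : Fin d) x {y} → y ≡ step a x → x ≡ a ∷ y ⊎ y ≡ a ∷ x
  step-neighbour a x refl = step-cases a x

  ∷-acyclic : ∀ {a} {x : Word d} → x ≢ a ∷ x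
  ∷-acyclic ()

  step≢ : ∀ (a : Fin d) x → step a x ≢ x
  step≢ a x step≡x with step-cases a x
  ... | inj₁ x≡a∷step = ∷-acyclic (trans x≡a∷step (cong (a ∷_) step≡x))
  ... | inj₂ step≡a∷x = ∷-acyclic (trans (sym step≡x) step≡a∷x)

  step-reduced : ∀ (a : Fin d) {x} → Reduced x → Reduced (step a x)
  step-reduced a {[]}    _ = red-1 a
  step-reduced a {b ∷ w} x-red with a F.≟ b | x-red
  ... | yes _   | red-1 _       = red-[]
  ... | yes _   | red-∷ _ w-red = w-red
  ... | no  a≢b | _             = red-∷ a≢b x-red

  Parent : Word d → Word d → Set
  Parent y []      = ⊥
  Parent y (_ ∷ w) = y ≡ w

  parent? : ∀ y x → Dec (Parent y x)
  parent? y []      = no λ ()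
  parent? y (_ ∷ w) = y ≟w w

  parent-asym : ∀ {x y} → Parent y x → Parent x y → ⊥
  parent-asym {_ ∷ _} {_ ∷ _} refl ()

  ∑-step-to-parent : ∀ {x y} → Parent y x → ∑[ a ∈ allFin d ] 𝟙 (y ≟w step a x) ≡ 1
  ∑-step-to-parent {b ∷ w} refl =
    trans (∑-single _ (allFin d) (Unique.allFin⁺ d) (∈-allFin b) other)
          (𝟙-yes _ (sym (step-parent b w)))
    where
    other : ∀ a → a ≢ b → 𝟙 (w ≟w step a (b ∷ w)) ≡ 0
    other a a≢b = 𝟙-no _ λ w≡ → case step-neighbour a (b ∷ w) w≡ of λ
      { (inj₁ b∷w≡a∷w) → a≢b (sym (LP.∷-injectiveˡ b∷w≡a∷w))
      ; (inj₂ ()) }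

  ∑-step-to-child : ∀ {x y} → Reduced y → Parent x y → ∑[ a ∈ allFin d ] 𝟙 (y ≟w step a x) ≡ 1
  ∑-step-to-child {x} {c ∷ _} y-red refl =
    trans (∑-single _ (allFin d) (Unique.allFin⁺ d) (∈-allFin c) other)
          (𝟙-yes _ (sym (step-child y-red)))
    where
    other : ∀ a → a ≢ c → 𝟙 ((c ∷ x) ≟w step a x) ≡ 0
    other a a≢c = 𝟙-no _ λ c∷x≡ → case step-neighbour a x c∷x≡ of λ
      { (inj₁ ())
      ; (inj₂ c∷x≡a∷x) → a≢c (sym (LP.∷-injectiveˡ c∷x≡a∷x)) }

  ∑-step≡parent+child : ∀ x {y} → Reduced y →
                        ∑[ a ∈ allFin d ] 𝟙 (y ≟w step a x) ≡ 𝟙 (parent? y x) + 𝟙 (parent? x y)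
  ∑-step≡parent+child x {y} y-red with parent? y x | parent? x y
  ... | yes p | yes q = ⊥-elim (parent-asym p q)
  ... | yes p | no  _ = ∑-step-to-parent p
  ... | no  _ | yes q = ∑-step-to-child y-red q
  ... | no ¬p | no ¬q = ∑-zero (allFin d) λ _ → 𝟙-no _ λ y≡ →
    [ ¬p ∘ parent , ¬q ∘ child ]′ (step-neighbour _ x y≡)
    where
    parent : ∀ {a} → x ≡ a ∷ y → Parent y x
    parent refl = refl
    child : ∀ {a} → y ≡ a ∷ x → Parent x y
    child refl = refl

  HasParentIn : List (Word d) → Word d → Set
  HasParentIn D []      = ⊥
  HasParentIn D (_ ∷ w) = w ∈ D

  hasParentIn? : ∀ D x → Dec (HasParentIn D x)
  hasParentIn? D []      = no λ ()
  hasParentIn? D (_ ∷ w) = w ∈?w D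

  module _ {D : List (Word d)} (reduced : All Reduced D) (distinct : Unique D) where

    deg≡∑parent+child : ∀ x → deg D x ≡ ∑[ y ∈ D ] (𝟙 (parent? y x) + 𝟙 (parent? x y))
    deg≡∑parent+child x = begin
      deg D x
        ≡⟨ length-filter≡∑𝟙 (λ a → step a x ∈?w D) (allFin d) ⟩
      ∑[ a ∈ allFin d ] 𝟙 (step a x ∈?w D)
        ≡⟨ ∑-cong (allFin d) (λ _ → sym (∑-𝟙-≟ _≟w_ distinct _)) ⟩
      ∑[ a ∈ allFin d ] ∑[ y ∈ D ] 𝟙 (y ≟w step a x)
        ≡⟨ ∑-swap (λ a y → 𝟙 (y ≟w step a x)) (allFin d) D ⟩
      ∑[ y ∈ D ] ∑[ a ∈ allFin d ] 𝟙 (y ≟w step a x)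
        ≡⟨ ∑-cong D (λ y∈D → ∑-step≡parent+child x (All.lookup reduced y∈D)) ⟩
      ∑[ y ∈ D ] (𝟙 (parent? y x) + 𝟙 (parent? x y)) ∎
      where open ≡-Reasoning

    ∑-parent≡hasParentIn : ∀ x → ∑[ y ∈ D ] 𝟙 (parent? y x) ≡ 𝟙 (hasParentIn? D x)
    ∑-parent≡hasParentIn []      = ∑-zero D (λ _ → refl)
    ∑-parent≡hasParentIn (_ ∷ w) = ∑-𝟙-≟ _≟w_ distinct w

    ∑-deg≡2*nonroots : ∑[ x ∈ D ] deg D x ≡
                       ∑[ x ∈ D ] 𝟙 (hasParentIn? D x) + ∑[ x ∈ D ] 𝟙 (hasParentIn? D x)
    ∑-deg≡2*nonroots = begin
      ∑[ x ∈ D ] deg D x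
        ≡⟨ ∑-cong D (λ _ → deg≡∑parent+child _) ⟩
      ∑[ x ∈ D ] ∑[ y ∈ D ] (𝟙 (parent? y x) + 𝟙 (parent? x y))
        ≡⟨ ∑-cong D (λ _ → ∑-distrib-+ _ _ D) ⟩
      ∑[ x ∈ D ] (∑[ y ∈ D ] 𝟙 (parent? y x) + ∑[ y ∈ D ] 𝟙 (parent? x y))
        ≡⟨ ∑-distrib-+ _ _ D ⟩
      ∑[ x ∈ D ] ∑[ y ∈ D ] 𝟙 (parent? y x) + ∑[ x ∈ D ] ∑[ y ∈ D ] 𝟙 (parent? x y)
        ≡⟨ cong (∑[ x ∈ D ] ∑[ y ∈ D ] 𝟙 (parent? y x) +_) (∑-swap (λ x y → 𝟙 (parent? x y)) D D) ⟩
      ∑[ x ∈ D ] ∑[ y ∈ D ] 𝟙 (parent? y x) + ∑[ y ∈ D ] ∑[ x ∈ D ] 𝟙 (parent? x y)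
        ≡⟨ cong₂ _+_ ∑∑parent≡nonroots ∑∑parent≡nonroots ⟩
      ∑[ x ∈ D ] 𝟙 (hasParentIn? D x) + ∑[ x ∈ D ] 𝟙 (hasParentIn? D x) ∎
      where
      open ≡-Reasoning
      ∑∑parent≡nonroots : ∑[ x ∈ D ] ∑[ y ∈ D ] 𝟙 (parent? y x) ≡ ∑[ x ∈ D ] 𝟙 (hasParentIn? D x)
      ∑∑parent≡nonroots = ∑-cong D (λ _ → ∑-parent≡hasParentIn _)

  walk-source∈ : ∀ {D : List (Word d)} {x y} → Walk D x y → x ∈ D
  walk-source∈ (here x∈D)      = x∈D
  walk-source∈ (there x∈D _ _) = x∈D

  walk-++ : ∀ {D : List (Word d)} {x y z} → Walk D x y → Walk D y z → Walk D x z
  walk-++ (here _)          q = q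
  walk-++ (there x∈D x~ p) q = there x∈D x~ (walk-++ p q)

  walk-first-step : ∀ {D : List (Word d)} {x y} → x ≢ y → Walk D x y → ∃ λ a → step a x ∈ D
  walk-first-step x≢x (here _)                = ⊥-elim (x≢x refl)
  walk-first-step _   (there _ (a , eq) walk) = a , subst (_∈ _) eq (walk-source∈ walk)

  Ancestor : Word d → Word d → Set
  Ancestor x z = ∃ λ u → z ≡ u ++ x

  walk-stays-below-root : ∀ {D x v z} → ¬ HasParentIn D x → Walk D v z → Ancestor x v → Ancestor x z
  walk-stays-below-root         x-root (here _)                          x≼v      = x≼v
  walk-stays-below-root {D} {x} x-root (there {y = v′} _ (a , v′≡) walk) (u , v≡) =
    walk-stays-below-root x-root walk (next (step-neighbour a _ v′≡) u v≡)
    where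
    next : ∀ {v} → v ≡ a ∷ v′ ⊎ v′ ≡ a ∷ v → ∀ u → v ≡ u ++ x → Ancestor x v′
    next (inj₂ v′≡a∷v) u       v≡ = a ∷ u , trans v′≡a∷v (cong (a ∷_) v≡)
    next (inj₁ v≡a∷v′) []      v≡ =
      ⊥-elim (x-root (subst (HasParentIn D) (trans (sym v≡a∷v′) v≡) (walk-source∈ walk)))
    next (inj₁ v≡a∷v′) (_ ∷ u) v≡ = u , LP.∷-injectiveʳ (trans (sym v≡a∷v′) v≡)

  module _ {D : List (Word d)} (dom : IsDomain d D) where
    open IsDomain dom

    root-exists : ∀ {x} → x ∈ D → ∃ λ r → r ∈ D × ¬ HasParentIn D r
    root-exists {[]}    []∈D = [] , []∈D , λ ()
    root-exists {_ ∷ w} x∈D with w ∈?w D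
    ... | yes w∈D = root-exists w∈D
    ... | no  w∉D = _ , x∈D , w∉D

    root-unique : ∀ {r s} → r ∈ D → s ∈ D → ¬ HasParentIn D r → ¬ HasParentIn D s → r ≡ s
    root-unique {r} r∈D s∈D r-root s-root
      with u , s≡u++r ← walk-stays-below-root r-root (connected r∈D s∈D) ([] , refl)
         | v , r≡v++s ← walk-stays-below-root s-root (connected s∈D r∈D) ([] , refl)
      = sym (trans s≡u++r (cong (_++ r) (LP.++-conicalʳ v u v++u≡[])))
      where
      v++u≡[] : v ++ u ≡ []
      v++u≡[] = LP.++-identityˡ-unique (v ++ u)
        (trans r≡v++s (trans (cong (v ++_) s≡u++r) (sym (LP.++-assoc v u r))))

    length-roots≡1 : length (filter (∁? (hasParentIn? D)) D) ≡ 1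
    length-roots≡1 with r , r∈D , r-root ← root-exists (proj₂ (nonempty⇒∈ nonempty)) =
      all-equal⇒length≡1 (Unique.filter⁺ (∁? (hasParentIn? D)) distinct)
                         (∈-filter⁺ (∁? (hasParentIn? D)) r∈D r-root)
                         (λ s∈roots → let s∈D , s-root = ∈-filter⁻ (∁? (hasParentIn? D)) s∈roots
                                      in root-unique s∈D r∈D s-root r-root)

    handshake : ∑[ x ∈ D ] deg D x + 2 ≡ length D + length D
    handshake = begin
      ∑[ x ∈ D ] deg D x + 2          ≡⟨ cong (_+ 2) (∑-deg≡2*nonroots vertices distinct) ⟩
      nonroots + nonroots + 2         ≡⟨ double+2 nonroots ⟩
      (nonroots + 1) + (nonroots + 1) ≡⟨ sym (cong₂ _+_ length≡nonroots+1 length≡nonroots+1) ⟩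
      length D + length D             ∎
      where
      open ≡-Reasoning
      nonroots : ℕ
      nonroots = ∑[ x ∈ D ] 𝟙 (hasParentIn? D x)
      double+2 : ∀ n → n + n + 2 ≡ (n + 1) + (n + 1)
      double+2 = solve-∀
      length≡nonroots+1 : length D ≡ nonroots + 1
      length≡nonroots+1 = trans (length-filter-split (hasParentIn? D) D)
                                (cong₂ _+_ (length-filter≡∑𝟙 (hasParentIn? D) D) length-roots≡1)

  ParentClosed : List (Word d) → Set
  ParentClosed D = ∀ {a w} → a ∷ w ∈ D → w ∈ D

  module _ {D : List (Word d)} (closed : ParentClosed D) where

    walk-to-root : ∀ {x} → x ∈ D → Walk D x []
    walk-to-root {[]}    []∈D = here []∈D
    walk-to-root {a ∷ w} x∈D  = there x∈D (a , sym (step-parent a w)) (walk-to-root (closed x∈D))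

    walk-from-root : All Reduced D → ∀ {x} → x ∈ D → Walk D [] x
    walk-from-root _       {[]}    []∈D = here []∈D
    walk-from-root reduced {a ∷ w} x∈D  =
      walk-++ (walk-from-root reduced (closed x∈D))
              (there (closed x∈D) (a , sym (step-child (All.lookup reduced x∈D))) (here x∈D))

    parentClosed⇒domain : All Reduced D → Unique D → [] ∈ D → IsDomain d D
    parentClosed⇒domain reduced distinct []∈D = record
      { vertices  = reduced
      ; distinct  = distinct
      ; nonempty  = λ { refl → case []∈D of λ () }
      ; connected = λ x∈D y∈D → walk-++ (walk-to-root x∈D) (walk-from-root reduced y∈D)
      }

  -- Interior, boundary and residual counts

  0<deg : ∀ {D x} → IsDomain d D → 2 ≤ length D → x ∈ D → 0 < deg D x
  0<deg {D} {x} dom 2≤|D| x∈D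
    with y , y∈D , x≢y ← ∃-≢ _≟w_ (IsDomain.distinct dom) 2≤|D| x∈D
    with a , ax∈D ← walk-first-step x≢y (IsDomain.connected dom x∈D y∈D)
    = ∈-length (∈-filter⁺ (λ a → step a x ∈?w D) (∈-allFin a) ax∈D)

  deg≤d : ∀ D x → deg D x ≤ d
  deg≤d D x = ≤-trans (LP.length-filter (λ a → step a x ∈?w D) (allFin d))
                      (≤-reflexive (LP.length-tabulate {n = d} id))

  interior : List (Word d) → List (Word d)
  interior D = filter (∁? (λ x → deg D x <? d)) D

  residual? : (D : List (Word d)) → Decidable (λ x → 2 ≤ deg D x × deg D x ≤ d ∸ 1)
  residual? D x = (2 ≤? deg D x) ×-dec (deg D x ≤? d ∸ 1)

  boundaryDegree : List (Word d) → ℕ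
  boundaryDegree D = ∑[ x ∈ boundary D ] deg D x

  length≡boundary+interior : ∀ D → length D ≡ length (boundary D) + length (interior D)
  length≡boundary+interior D = length-filter-split (λ x → deg D x <? d) D

  same-size : ∀ {D D′ : List (Word d)} → length D′ ≡ length D →
              length (boundary D) + length (interior D) ≡ length (boundary D′) + length (interior D′)
  same-size {D} {D′} |D′|≡|D| =
    trans (sym (length≡boundary+interior D)) (trans (sym |D′|≡|D|) (length≡boundary+interior D′))

  ∑-deg≡boundaryDegree+ : ∀ D → ∑[ x ∈ D ] deg D x ≡ boundaryDegree D + length (interior D) * d
  ∑-deg≡boundaryDegree+ D = trans (∑-filter-split (λ x → deg D x <? d) (deg D) D)
                                  (cong (boundaryDegree D +_) (∑-const (interior D) deg≡d))
    where
    deg≡d : ∀ {x} → x ∈ interior D → deg D x ≡ d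
    deg≡d {x} x∈int =
      ≤-antisym (deg≤d D x) (≮⇒≥ (proj₂ (∈-filter⁻ (∁? (λ x → deg D x <? d)) {xs = D} x∈int)))

  degree-identity : ∀ {D} → IsDomain d D →
                    boundaryDegree D + length (interior D) * d + 2 ≡ length D + length D
  degree-identity {D} dom = trans (cong (_+ 2) (sym (∑-deg≡boundaryDegree+ D))) (handshake dom)

  boundary-deg-lower : ∀ {D x} → IsDomain d D → 2 ≤ length D → x ∈ boundary D →
                       1 + 𝟙 (residual? D x) ≤ deg D x
  boundary-deg-lower {D} {x} dom 2≤|D| x∈∂D with residual? D x
  ... | yes (2≤deg , _) = 2≤deg
  ... | no  _           = 0<deg dom 2≤|D| (proj₁ (∈-filter⁻ (λ x → deg D x <? d) {xs = D} x∈∂D))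

  boundaryDegree-lower : ∀ {D} → IsDomain d D → 2 ≤ length D →
                         length (boundary D) + length (residualBoundary D) ≤ boundaryDegree D
  boundaryDegree-lower {D} dom 2≤|D| = begin
    length (boundary D) + length (residualBoundary D)
      ≡⟨ cong₂ _+_ (length≡∑1 (boundary D)) (length-filter≡∑𝟙 (residual? D) (boundary D)) ⟩
    ∑[ x ∈ boundary D ] 1 + ∑[ x ∈ boundary D ] 𝟙 (residual? D x)
      ≡⟨ sym (∑-distrib-+ (λ _ → 1) (λ x → 𝟙 (residual? D x)) (boundary D)) ⟩
    ∑[ x ∈ boundary D ] (1 + 𝟙 (residual? D x))
      ≤⟨ ∑-mono-≤ (boundary D) (boundary-deg-lower dom 2≤|D|) ⟩
    boundaryDegree D ∎
    where open ≤-Reasoning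

  full⇒residual≡[] : ∀ {D} → Full d D → residualBoundary D ≡ []
  full⇒residual≡[] {D} (_ , leaf) = LP.filter-none (residual? D) (All.tabulate not-residual)
    where
    not-residual : ∀ {x} → x ∈ boundary D → ¬ (2 ≤ deg D x × deg D x ≤ d ∸ 1)
    not-residual x∈∂D (2≤deg , _)
      with deg≡1 ← proj₂ (∈-filter⁻ (λ x → deg D x ≟ 1) {xs = boundary D} (leaf x∈∂D)) =
      1+n≰n (subst (2 ≤_) deg≡1 2≤deg)

  deg-singleton : ∀ x → deg (x ∷ []) x ≡ 0
  deg-singleton x =
    cong length (LP.filter-none (λ a → step a x ∈?w (x ∷ [])) {xs = allFin d} (All.tabulate λ {a} _ → ∉x a))
    where
    ∉x : ∀ a → step a x ∉ x ∷ []
    ∉x a (here step≡x) = step≢ a x step≡x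

  length-boundary-singleton : ∀ {x} → 0 < d → length (boundary (x ∷ [])) ≡ 1
  length-boundary-singleton {x} 0<d =
    cong length (LP.filter-accept (λ y → deg (x ∷ []) y <? d) (subst (_< d) (sym (deg-singleton x)) 0<d))

  singleton-optimal : ∀ {x} → 0 < d → Optimal d (x ∷ [])
  singleton-optimal 0<d (_ ∷ [])    _ _  =
    ≤-reflexive (trans (length-boundary-singleton 0<d) (sym (length-boundary-singleton 0<d)))
  singleton-optimal 0<d []          _ ()
  singleton-optimal 0<d (_ ∷ _ ∷ _) _ ()

-- Optimality

m+n≡o+p⇒m≤o⇒p≤n : ∀ {m n o p} → m + n ≡ o + p → m ≤ o → p ≤ n
m+n≡o+p⇒m≤o⇒p≤n {m} {n} {o} {p} eq m≤o = +-cancelˡ-≤ o p n (begin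
  o + p ≡⟨ sym eq ⟩
  m + n ≤⟨ +-monoˡ-≤ n m≤o ⟩
  o + n ∎)
  where open ≤-Reasoning

m+n≡o+p⇒p≤n⇒m≤o : ∀ {m n o p} → m + n ≡ o + p → p ≤ n → m ≤ o
m+n≡o+p⇒p≤n⇒m≤o {m} {n} {o} {p} eq =
  m+n≡o+p⇒m≤o⇒p≤n (trans (+-comm p o) (trans (sym eq) (+-comm m n)))

module _ {e : ℕ} where

  private
    d : ℕ
    d = 2 + e

  boundary-deg-upper : ∀ {D x} → x ∈ boundary D → deg D x ≤ 1 + e * 𝟙 (residual? D x)
  boundary-deg-upper {D} {x} x∈∂D with residual? D x
  ... | yes (_ , deg≤1+e) = ≤-trans deg≤1+e (≤-reflexive (cong suc (sym (*-identityʳ e))))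
  ... | no  ¬residual     = ≤-trans (≤-pred (≰⇒> (λ 2≤deg → ¬residual (2≤deg , ≤-pred deg<d))))
                                    (≤-reflexive (cong suc (sym (*-zeroʳ e))))
    where
    deg<d : deg D x < d
    deg<d = proj₂ (∈-filter⁻ (λ x → deg D x <? d) {xs = D} x∈∂D)

  boundaryDegree-upper : ∀ D → boundaryDegree D ≤ length (boundary D) + e * length (residualBoundary D)
  boundaryDegree-upper D = begin
    boundaryDegree D
      ≤⟨ ∑-mono-≤ (boundary D) (boundary-deg-upper {D}) ⟩
    ∑[ x ∈ boundary D ] (1 + e * 𝟙 (residual? D x))
      ≡⟨ ∑-distrib-+ (λ _ → 1) (λ x → e * 𝟙 (residual? D x)) (boundary D) ⟩
    ∑[ x ∈ boundary D ] 1 + ∑[ x ∈ boundary D ] (e * 𝟙 (residual? D x))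
      ≡⟨ cong₂ _+_ (sym (length≡∑1 (boundary D))) (∑-distribˡ-* e (λ x → 𝟙 (residual? D x)) (boundary D)) ⟩
    length (boundary D) + e * ∑[ x ∈ boundary D ] 𝟙 (residual? D x)
      ≡⟨ cong (λ r → length (boundary D) + e * r) (sym (length-filter≡∑𝟙 (residual? D) (boundary D))) ⟩
    length (boundary D) + e * length (residualBoundary D) ∎
    where open ≤-Reasoning

  interior-bound : ∀ {D} → IsDomain d D → 2 ≤ length D →
                   length (interior D) * suc e + 2 + length (residualBoundary D) ≤ length D
  interior-bound {D} dom 2≤|D| = +-cancelˡ-≤ k _ _ (begin
    k + (m * suc e + 2 + r)       ≡⟨ cong (_+ (m * suc e + 2 + r)) (length≡boundary+interior D) ⟩
    (b + m) + (m * suc e + 2 + r) ≡⟨ rearrange e b m r ⟩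
    (b + r) + m * d + 2           ≤⟨ +-monoˡ-≤ 2 (+-monoˡ-≤ (m * d) (boundaryDegree-lower dom 2≤|D|)) ⟩
    boundaryDegree D + m * d + 2  ≡⟨ degree-identity dom ⟩
    k + k                         ∎)
    where
    open ≤-Reasoning
    k b m r : ℕ
    k = length D
    b = length (boundary D)
    m = length (interior D)
    r = length (residualBoundary D)
    rearrange : ∀ e b m r → (b + m) + (m * suc e + 2 + r) ≡ (b + r) + m * (2 + e) + 2
    rearrange = solve-∀

  size-bound : ∀ {D} → IsDomain d D →
               length D ≤ length (interior D) * suc e + 2 + e * length (residualBoundary D)
  size-bound {D} dom = +-cancelˡ-≤ k _ _ (begin
    k + k                             ≡⟨ sym (degree-identity dom) ⟩
    boundaryDegree D + m * d + 2      ≤⟨ +-monoˡ-≤ 2 (+-monoˡ-≤ (m * d) (boundaryDegree-upper D)) ⟩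
    (b + e * r) + m * d + 2           ≡⟨ rearrange e b m r ⟩
    (b + m) + (m * suc e + 2 + e * r) ≡⟨ cong (_+ (m * suc e + 2 + e * r)) (sym (length≡boundary+interior D)) ⟩
    k + (m * suc e + 2 + e * r)       ∎)
    where
    open ≤-Reasoning
    k b m r : ℕ
    k = length D
    b = length (boundary D)
    m = length (interior D)
    r = length (residualBoundary D)
    rearrange : ∀ e b m r → (b + e * r) + m * (2 + e) + 2 ≡ (b + m) + (m * suc e + 2 + e * r)
    rearrange = solve-∀

  m*[d-1]+2≤n*[d-1]+d⇒m≤n : ∀ {m n} → m * suc e + 2 ≤ n * suc e + d → m ≤ n
  m*[d-1]+2≤n*[d-1]+d⇒m≤n {m} {n} le = ≤-pred (*-cancelʳ-< (suc e) m (suc n) (begin-strict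
    m * suc e     ≤⟨ +-cancelʳ-≤ 2 (m * suc e) (n * suc e + e) (≤-trans le (≤-reflexive (rearrange e n))) ⟩
    n * suc e + e <⟨ ≤-reflexive (rearrange′ e n) ⟩
    suc n * suc e ∎))
    where
    open ≤-Reasoning
    rearrange : ∀ e n → n * suc e + (2 + e) ≡ n * suc e + e + 2
    rearrange = solve-∀
    rearrange′ : ∀ e n → suc (n * suc e + e) ≡ suc n * suc e
    rearrange′ = solve-∀

  -- By interior-bound, (d − 1)·|interior D| + 2 ≤ |D| once |D| ≥ 2, so this says that
  -- |interior D| attains ⌊(|D| − 2)/(d − 1)⌋, the most a domain of its size can have.
  HasMaximalInterior : List (Word d) → Set
  HasMaximalInterior D = length D ≤ length (interior D) * suc e + d

  maximal-interior⇒optimal : ∀ {D} → IsDomain d D → 2 ≤ length D → HasMaximalInterior D → Optimal d D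
  maximal-interior⇒optimal {D} dom 2≤|D| maximal D′ dom′ |D′|≡|D| =
    m+n≡o+p⇒p≤n⇒m≤o (same-size {D = D} {D′} |D′|≡|D|) m′≤m
    where
    m′≤m : length (interior D′) ≤ length (interior D)
    m′≤m = m*[d-1]+2≤n*[d-1]+d⇒m≤n (begin
      length (interior D′) * suc e + 2
        ≤⟨ m≤m+n _ _ ⟩
      length (interior D′) * suc e + 2 + length (residualBoundary D′)
        ≤⟨ interior-bound dom′ (subst (2 ≤_) (sym |D′|≡|D|) 2≤|D|) ⟩
      length D′
        ≡⟨ |D′|≡|D| ⟩
      length D
        ≤⟨ maximal ⟩
      length (interior D) * suc e + d ∎)
      where open ≤-Reasoning

  residual≤1⇒maximal-interior : ∀ {D} → IsDomain d D → length (residualBoundary D) ≤ 1 →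
                                HasMaximalInterior D
  residual≤1⇒maximal-interior {D} dom r≤1 = begin
    length D
      ≤⟨ size-bound dom ⟩
    length (interior D) * suc e + 2 + e * length (residualBoundary D)
      ≤⟨ +-monoʳ-≤ _ (≤-trans (*-monoʳ-≤ e r≤1) (≤-reflexive (*-identityʳ e))) ⟩
    length (interior D) * suc e + 2 + e
      ≡⟨ +-assoc _ 2 e ⟩
    length (interior D) * suc e + d ∎
    where open ≤-Reasoning

  residual≤1⇒optimal : ∀ {D} → IsDomain d D → 2 ≤ length D → length (residualBoundary D) ≤ 1 →
                       Optimal d D
  residual≤1⇒optimal dom 2≤|D| r≤1 =
    maximal-interior⇒optimal dom 2≤|D| (residual≤1⇒maximal-interior dom r≤1)

  maximal-interior⇒residual≤d-2 : ∀ {D} → IsDomain d D → 2 ≤ length D → HasMaximalInterior D →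
                                  length (residualBoundary D) ≤ e
  maximal-interior⇒residual≤d-2 {D} dom 2≤|D| maximal =
    +-cancelˡ-≤ (length (interior D) * suc e + 2) _ _ (begin
      length (interior D) * suc e + 2 + length (residualBoundary D) ≤⟨ interior-bound dom 2≤|D| ⟩
      length D                                                      ≤⟨ maximal ⟩
      length (interior D) * suc e + (2 + e)                         ≡⟨ sym (+-assoc _ 2 e) ⟩
      length (interior D) * suc e + 2 + e                           ∎)
    where open ≤-Reasoning

  -- spine i is the path 0101… of length i from the root, block i lists the children of
  -- spine i other than spine (i − 1), and caterpillar n r consists of the blocks below
  -- spine n together with r children of spine n: every spine i with i < n is interior.
  module Caterpillar where

    other : Fin d → Fin d
    other F.zero    = F.suc F.zero
    other (F.suc _) = F.zero

    other≢ : ∀ a → other a ≢ a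
    other≢ F.zero    ()
    other≢ (F.suc _) ()

    spineLetter : ℕ → Fin d
    spineLetter zero    = F.zero
    spineLetter (suc i) = other (spineLetter i)

    spine : ℕ → Word d
    spine zero    = []
    spine (suc i) = spineLetter i ∷ spine i

    spine-reduced : ∀ i → Reduced (spine i)
    spine-reduced zero          = red-[]
    spine-reduced (suc zero)    = red-1 _
    spine-reduced (suc (suc i)) = red-∷ (other≢ _) (spine-reduced (suc i))

    length-spine : ∀ i → length (spine i) ≡ i
    length-spine zero    = refl
    length-spine (suc i) = cong suc (length-spine i)

    childLetters : ℕ → List (Fin d)
    childLetters zero    = allFin d
    childLetters (suc i) = map (punchIn (spineLetter i)) (allFin (suc e))

    ∈-childLetters : ∀ {i a} → Reduced (a ∷ spine i) → a ∈ childLetters i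
    ∈-childLetters {zero}  _             = ∈-allFin _
    ∈-childLetters {suc i} (red-∷ a≢b _) = subst (_∈ _) (FP.punchIn-punchOut b≢a)
                                                 (∈-map⁺ (punchIn (spineLetter i)) (∈-allFin (punchOut b≢a)))
      where
      b≢a : spineLetter i ≢ _
      b≢a b≡a = a≢b (sym b≡a)

    childLetters-reduced : ∀ {i a} → a ∈ childLetters i → Reduced (a ∷ spine i)
    childLetters-reduced {zero}  _ = red-1 _
    childLetters-reduced {suc i} a∈ with j , _ , refl ← ∈-map⁻ (punchIn (spineLetter i)) a∈ =
      red-∷ (FP.punchInᵢ≢i _ j) (spine-reduced (suc i))

    childLetters-unique : ∀ i → Unique (childLetters i)
    childLetters-unique zero    = Unique.allFin⁺ d
    childLetters-unique (suc i) =
      Unique.map⁺ (FP.punchIn-injective (spineLetter i) _ _) (Unique.allFin⁺ (suc e))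

    length-childLetters-zero : length (childLetters zero) ≡ d
    length-childLetters-zero = LP.length-tabulate {n = d} id

    length-childLetters-suc : ∀ i → length (childLetters (suc i)) ≡ suc e
    length-childLetters-suc i = trans (LP.length-map _ (allFin (suc e))) (LP.length-tabulate {n = suc e} id)

    block : ℕ → List (Word d)
    block i = map (_∷ spine i) (childLetters i)

    ∈-block⁺ : ∀ {i a} → Reduced (a ∷ spine i) → a ∷ spine i ∈ block i
    ∈-block⁺ {i} a∷spine-reduced = ∈-map⁺ (_∷ spine i) (∈-childLetters a∷spine-reduced)

    ∈-block⁻ : ∀ {i x} → x ∈ block i → ∃ λ a → x ≡ a ∷ spine i × Reduced x
    ∈-block⁻ {i} x∈ with a , a∈ , refl ← ∈-map⁻ (_∷ spine i) x∈ = a , refl , childLetters-reduced a∈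

    length-∈-block : ∀ {i x} → x ∈ block i → length x ≡ suc i
    length-∈-block {i} x∈ with _ , refl , _ ← ∈-block⁻ x∈ = cong suc (length-spine i)

    block-unique : ∀ i → Unique (block i)
    block-unique i = Unique.map⁺ LP.∷-injectiveˡ (childLetters-unique i)

    0<length-block : ∀ n → 0 < length (block n)
    0<length-block n = ∈-length (∈-block⁺ (spine-reduced (suc n)))

    fullCaterpillar : ℕ → List (Word d)
    fullCaterpillar zero    = [] ∷ []
    fullCaterpillar (suc n) = block n ++ fullCaterpillar n

    ∈-fullCaterpillar⁻ : ∀ n {x} → x ∈ fullCaterpillar n → x ≡ [] ⊎ ∃ λ i → i < n × x ∈ block i
    ∈-fullCaterpillar⁻ zero    (here refl) = inj₁ refl
    ∈-fullCaterpillar⁻ (suc n) x∈ with ∈-++⁻ (block n) x∈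
    ... | inj₁ x∈block = inj₂ (n , ≤-refl , x∈block)
    ... | inj₂ x∈full  = Sum.map₂ (λ (i , i<n , x∈block) → i , m≤n⇒m≤1+n i<n , x∈block)
                                  (∈-fullCaterpillar⁻ n x∈full)

    block⊆fullCaterpillar : ∀ {i n x} → i < n → x ∈ block i → x ∈ fullCaterpillar n
    block⊆fullCaterpillar {n = suc n} i<1+n x∈ with m<1+n⇒m<n∨m≡n i<1+n
    ... | inj₁ i<n  = ∈-++⁺ʳ (block n) (block⊆fullCaterpillar i<n x∈)
    ... | inj₂ refl = ∈-++⁺ˡ x∈

    []∈fullCaterpillar : ∀ n → [] ∈ fullCaterpillar n
    []∈fullCaterpillar zero    = here refl
    []∈fullCaterpillar (suc n) = ∈-++⁺ʳ (block n) ([]∈fullCaterpillar n)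

    spine∈fullCaterpillar : ∀ {i n} → i ≤ n → spine i ∈ fullCaterpillar n
    spine∈fullCaterpillar {zero}  {n} _   = []∈fullCaterpillar n
    spine∈fullCaterpillar {suc i}     i<n = block⊆fullCaterpillar i<n (∈-block⁺ (spine-reduced (suc i)))

    length-∈-fullCaterpillar : ∀ n {x} → x ∈ fullCaterpillar n → length x ≤ n
    length-∈-fullCaterpillar n x∈ with ∈-fullCaterpillar⁻ n x∈
    ... | inj₁ refl                = z≤n
    ... | inj₂ (i , i<n , x∈block) = ≤-trans (≤-reflexive (length-∈-block x∈block)) i<n

    block-disjoint : ∀ {n x} → x ∈ block n → x ∉ fullCaterpillar n
    block-disjoint {n} x∈block x∈full =
      1+n≰n (subst (_≤ n) (length-∈-block x∈block) (length-∈-fullCaterpillar n x∈full))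

    fullCaterpillar-unique : ∀ n → Unique (fullCaterpillar n)
    fullCaterpillar-unique zero    = [] ∷ []
    fullCaterpillar-unique (suc n) = Unique.++⁺ (block-unique n) (fullCaterpillar-unique n)
                                                (λ (x∈block , x∈full) → block-disjoint x∈block x∈full)

    length-fullCaterpillar+block : ∀ n → length (fullCaterpillar n) + length (block n) ≡ n * suc e + (3 + e)
    length-fullCaterpillar+block zero    =
      cong suc (trans (LP.length-map _ (childLetters zero)) length-childLetters-zero)
    length-fullCaterpillar+block (suc n) = begin
      length (block n ++ fullCaterpillar n) + length (block (suc n))
        ≡⟨ cong₂ _+_ (LP.length-++ (block n))
                     (trans (LP.length-map _ (childLetters (suc n))) (length-childLetters-suc n)) ⟩
      length (block n) + length (fullCaterpillar n) + suc e
        ≡⟨ cong (_+ suc e) (trans (+-comm (length (block n)) _) (length-fullCaterpillar+block n)) ⟩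
      n * suc e + (3 + e) + suc e
        ≡⟨ rearrange e n ⟩
      suc n * suc e + (3 + e) ∎
      where
      open ≡-Reasoning
      rearrange : ∀ e n → n * suc e + (3 + e) + suc e ≡ suc n * suc e + (3 + e)
      rearrange = solve-∀

    size-decomposition : ∀ k → ∃ λ n → ∃ λ r → r < length (block n) × suc k ≡ r + length (fullCaterpillar n)
    size-decomposition zero = 0 , 0 , 0<length-block 0 , refl
    size-decomposition (suc k)
      with n , r , r<|block| , 1+k≡ ← size-decomposition k
      with m≤n⇒m<n∨m≡n r<|block|
    ... | inj₁ 1+r<|block| = n , suc r , 1+r<|block| , cong suc 1+k≡
    ... | inj₂ 1+r≡|block| = suc n , 0 , 0<length-block (suc n) , (begin
      suc (suc k)                                     ≡⟨ cong suc 1+k≡ ⟩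
      suc r + length (fullCaterpillar n)              ≡⟨ cong (_+ length (fullCaterpillar n)) 1+r≡|block| ⟩
      length (block n) + length (fullCaterpillar n)   ≡⟨ sym (LP.length-++ (block n)) ⟩
      length (fullCaterpillar (suc n))                ∎)
      where open ≡-Reasoning

    module _ (n r : ℕ) where

      caterpillar : List (Word d)
      caterpillar = take r (block n) ++ fullCaterpillar n

      take⊆block : ∀ {x} → x ∈ take r (block n) → x ∈ block n
      take⊆block = Sublist.lookup (Sublist.take-⊆ r (block n))

      fullCaterpillar⊆caterpillar : ∀ {x} → x ∈ fullCaterpillar n → x ∈ caterpillar
      fullCaterpillar⊆caterpillar = ∈-++⁺ʳ (take r (block n))

      ∈-caterpillar⁻ : ∀ {x} → x ∈ caterpillar → x ≡ [] ⊎ ∃ λ i → i ≤ n × x ∈ block i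
      ∈-caterpillar⁻ x∈ with ∈-++⁻ (take r (block n)) x∈
      ... | inj₁ x∈take = inj₂ (n , ≤-refl , take⊆block x∈take)
      ... | inj₂ x∈full = Sum.map₂ (λ (i , i<n , x∈block) → i , <⇒≤ i<n , x∈block)
                                   (∈-fullCaterpillar⁻ n x∈full)

      caterpillar-domain : IsDomain d caterpillar
      caterpillar-domain =
        parentClosed⇒domain closed reduced distinct (fullCaterpillar⊆caterpillar ([]∈fullCaterpillar n))
        where
        closed : ParentClosed caterpillar
        closed a∷w∈ with ∈-caterpillar⁻ a∷w∈
        ... | inj₂ (i , i≤n , a∷w∈block) with _ , refl , _ ← ∈-block⁻ a∷w∈block =
          fullCaterpillar⊆caterpillar (spine∈fullCaterpillar i≤n)
        reduced : All Reduced caterpillar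
        reduced = All.tabulate λ x∈ → case ∈-caterpillar⁻ x∈ of λ
          { (inj₁ refl)              → red-[]
          ; (inj₂ (_ , _ , x∈block)) → proj₂ (proj₂ (∈-block⁻ x∈block)) }
        distinct : Unique caterpillar
        distinct = Unique.++⁺ (Unique.take⁺ r (block-unique n)) (fullCaterpillar-unique n)
                              (λ (x∈take , x∈full) → block-disjoint (take⊆block x∈take) x∈full)

      spine-neighbour∈caterpillar : ∀ {i} → i < n → ∀ a → step a (spine i) ∈ caterpillar
      spine-neighbour∈caterpillar {i} i<n a with step-cases a (spine i)
      spine-neighbour∈caterpillar {suc i} i<n a | inj₁ spine≡ =
        subst (_∈ caterpillar) (LP.∷-injectiveʳ spine≡)
              (fullCaterpillar⊆caterpillar (spine∈fullCaterpillar (≤-trans (n≤1+n i) (<⇒≤ i<n))))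
      spine-neighbour∈caterpillar {i}     i<n a | inj₂ step≡ =
        subst (_∈ caterpillar) (sym step≡)
              (fullCaterpillar⊆caterpillar (block⊆fullCaterpillar i<n (∈-block⁺ a∷spine-reduced)))
        where
        a∷spine-reduced : Reduced (a ∷ spine i)
        a∷spine-reduced = subst Reduced step≡ (step-reduced a (spine-reduced i))

      spine∈interior : ∀ {i} → i < n → spine i ∈ interior caterpillar
      spine∈interior {i} i<n =
        ∈-filter⁺ (∁? (λ x → deg caterpillar x <? d))
                  (fullCaterpillar⊆caterpillar (spine∈fullCaterpillar (<⇒≤ i<n)))
                  (λ deg<d → 1+n≰n (subst (_< d) deg≡d deg<d))
        where
        deg≡d : deg caterpillar (spine i) ≡ d
        deg≡d = trans (cong length (LP.filter-all (λ a → step a (spine i) ∈?w caterpillar)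
                                                  (All.tabulate (λ {a} _ → spine-neighbour∈caterpillar i<n a))))
                      (LP.length-tabulate {n = d} id)

      n≤length-interior : n ≤ length (interior caterpillar)
      n≤length-interior =
        injective⇒≤length (spine ∘ F.toℕ) spine-injective (λ i → spine∈interior (FP.toℕ<n i))
        where
        spine-injective : ∀ {i j} → spine (F.toℕ i) ≡ spine (F.toℕ j) → i ≡ j
        spine-injective {i} {j} eq = FP.toℕ-injective
          (trans (sym (length-spine (F.toℕ i))) (trans (cong length eq) (length-spine (F.toℕ j))))

      length-caterpillar : r ≤ length (block n) → length caterpillar ≡ r + length (fullCaterpillar n)
      length-caterpillar r≤|block| = trans (LP.length-++ (take r (block n)))
        (cong (_+ length (fullCaterpillar n)) (trans (LP.length-take r (block n)) (m≤n⇒m⊓n≡m r≤|block|)))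

    maximal-interior-domain : ∀ k → ∃ λ D → IsDomain d D × length D ≡ suc k × HasMaximalInterior D
    maximal-interior-domain k with n , r , r<|block| , 1+k≡ ← size-decomposition k =
      caterpillar n r , caterpillar-domain n r , trans |caterpillar| (sym 1+k≡) , maximal
      where
      open ≤-Reasoning
      |caterpillar| : length (caterpillar n r) ≡ r + length (fullCaterpillar n)
      |caterpillar| = length-caterpillar n r (<⇒≤ r<|block|)
      maximal : length (caterpillar n r) ≤ length (interior (caterpillar n r)) * suc e + d
      maximal = begin
        length (caterpillar n r)                    ≡⟨ |caterpillar| ⟩
        r + length (fullCaterpillar n)              ≤⟨ ≤-pred (begin
          suc r + length (fullCaterpillar n)            ≤⟨ +-monoˡ-≤ _ r<|block| ⟩
          length (block n) + length (fullCaterpillar n) ≡⟨ +-comm (length (block n)) _ ⟩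
          length (fullCaterpillar n) + length (block n) ≡⟨ length-fullCaterpillar+block n ⟩
          n * suc e + (3 + e)                           ≡⟨ +-suc (n * suc e) d ⟩
          suc (n * suc e + d)                           ∎) ⟩
        n * suc e + d                               ≤⟨ +-monoˡ-≤ d (*-monoˡ-≤ (suc e) (n≤length-interior n r)) ⟩
        length (interior (caterpillar n r)) * suc e + d ∎

  optimal⇒maximal-interior : ∀ {D} → IsDomain d D → Optimal d D → HasMaximalInterior D
  optimal⇒maximal-interior {[]}          dom _ = ⊥-elim (IsDomain.nonempty dom refl)
  optimal⇒maximal-interior {D@(_ ∷ xs)} dom optimal
    with C , C-domain , |C|≡|D| , C-maximal ← Caterpillar.maximal-interior-domain (length xs) =
    ≤-trans (subst (_≤ length (interior C) * suc e + d) |C|≡|D| C-maximal)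
            (+-monoˡ-≤ d (*-monoˡ-≤ (suc e) mC≤mD))
    where
    mC≤mD : length (interior C) ≤ length (interior D)
    mC≤mD = m+n≡o+p⇒m≤o⇒p≤n (same-size {D = D} {C} |C|≡|D|) (optimal C C-domain |C|≡|D|)

  small⇒optimal : ∀ D → IsDomain d D → length D ≤ d → Optimal d D
  small⇒optimal []              dom _    = ⊥-elim (IsDomain.nonempty dom refl)
  small⇒optimal (x ∷ [])        _   _    = singleton-optimal {x = x} (s≤s z≤n)
  small⇒optimal D@(_ ∷ _ ∷ _) dom |D|≤d =
    maximal-interior⇒optimal dom (s≤s (s≤s z≤n)) (≤-trans |D|≤d (m≤n+m d _))

corollary4p4 : (d : ℕ) → 2 ≤ d →
    ((D : List (Word d)) → IsDomain d D → length D ≤ d → Optimal d D)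
    × ((D : List (Word d)) → IsDomain d D → Full d D → Optimal d D)
    × ((D : List (Word d)) → IsDomain d D → 2 ≤ length D →
         length (residualBoundary D) ≡ 1 → Optimal d D)
    × ((D : List (Word d)) → IsDomain d D → Optimal d D → 2 ≤ length D →
         length (residualBoundary D) ≤ d ∸ 2)
corollary4p4 (suc zero) (s≤s ())
corollary4p4 (suc (suc e)) _ =
    small⇒optimal
  , (λ D dom full@(2≤|D| , _) →
       residual≤1⇒optimal dom 2≤|D| (m≤n⇒m≤1+n (≤-reflexive (cong length (full⇒residual≡[] {D = D} full)))))
  , (λ D dom 2≤|D| |R|≡1 → residual≤1⇒optimal dom 2≤|D| (≤-reflexive |R|≡1))
  , (λ D dom optimal 2≤|D| →
       maximal-interior⇒residual≤d-2 dom 2≤|D| (optimal⇒maximal-interior dom optimal))
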